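{- For any integer $t\geq 2$, there exist a connected graph $G$ and a function $g:V(G_1)\to V(G_2)$ (where $G_1,G_2$ are disjoint copies of $G$) such that $fix(F_G)-fix(G)=t$.
   Context: All graphs are finite and simple. A set $S\subseteq V(H)$ is a fixing set of a graph $H$ if the only automorphism of $H$ fixing every vertex of $S$ is the identity; $fix(H)$ is the minimum cardinality of a fixing set of $H$. Functigraph: for disjoint copies $G_1,G_2$ of $G$, $A=V(G_1)$, $B=V(G_2)$ and a function $g:A\to B$, $F_G$ is the graph with vertex set $A\cup B$ and edge set $E(G_1)\cup E(G_2)\cup\{uv:u\in A,\ v=g(u)\}$. -}

module Defs where

open import Data.Nat using (ℕ; _≤_)
open import Data.Bool using (Bool; true; false)
open import Data.Fin using (Fin; _≟_)
open import Data.Sum using (_⊎_; inj₁; inj₂)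
open import Data.Product using (Σ; _×_; _,_)
open import Data.List using (List; length)
open import Data.List.Membership.Propositional using (_∈_)
open import Data.List.Relation.Unary.Unique.Propositional using (Unique)
open import Relation.Nullary.Decidable using (⌊_⌋)
open import Relation.Binary.PropositionalEquality using (_≡_; refl)

record Graph (V : Set) : Set where
  field
    adj    : V → V → Bool
    sym    : ∀ u v → adj u v ≡ adj v u
    irrefl : ∀ v → adj v v ≡ false
open Graph public

data Walk {V : Set} (G : Graph V) : V → V → Set where
  here : ∀ {u} → Walk G u u
  step : ∀ {u w v} → adj G u w ≡ true → Walk G w v → Walk G u v

Connected : {V : Set} → Graph V → Set
Connected {V} G = (u v : V) → Walk G u v

record Aut {V : Set} (G : Graph V) : Set where
  field
    fun     : V → V
    inv     : V → V
    left    : ∀ v → inv (fun v) ≡ v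
    right   : ∀ v → fun (inv v) ≡ v
    preserv : ∀ u v → adj G (fun u) (fun v) ≡ adj G u v
open Aut public

FixingSet : {V : Set} → Graph V → List V → Set
FixingSet {V} G S =
  (σ : Aut G) → (∀ v → v ∈ S → fun σ v ≡ v) → ∀ v → fun σ v ≡ v

IsFixNumber : {V : Set} → Graph V → ℕ → Set
IsFixNumber {V} G k =
  (Σ (List V) λ S → Unique S × length S ≡ k × FixingSet G S)
  × ((S : List V) → Unique S → FixingSet G S → k ≤ length S)

-- Functigraph F_G: vertices inj₁ = A = V(G₁), inj₂ = B = V(G₂)
fgAdj : {n : ℕ} → Graph (Fin n) → (Fin n → Fin n) → Fin n ⊎ Fin n → Fin n ⊎ Fin n → Bool
fgAdj G g (inj₁ a) (inj₁ b) = adj G a b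
fgAdj G g (inj₂ a) (inj₂ b) = adj G a b
fgAdj G g (inj₁ a) (inj₂ b) = ⌊ g a ≟ b ⌋
fgAdj G g (inj₂ b) (inj₁ a) = ⌊ g a ≟ b ⌋

fgSym : {n : ℕ} (G : Graph (Fin n)) (g : Fin n → Fin n) → ∀ u v → fgAdj G g u v ≡ fgAdj G g v u
fgSym G g (inj₁ a) (inj₁ b) = sym G a b
fgSym G g (inj₂ a) (inj₂ b) = sym G a b
fgSym G g (inj₁ a) (inj₂ b) = refl
fgSym G g (inj₂ b) (inj₁ a) = refl

fgIrr : {n : ℕ} (G : Graph (Fin n)) (g : Fin n → Fin n) → ∀ v → fgAdj G g v v ≡ false
fgIrr G g (inj₁ a) = irrefl G a
fgIrr G g (inj₂ a) = irrefl G a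

Functigraph : {n : ℕ} → Graph (Fin n) → (Fin n → Fin n) → Graph (Fin n ⊎ Fin n)
Functigraph G g = record { adj = fgAdj G g ; sym = fgSym G g ; irrefl = fgIrr G g }

-- Take G = Kₙ (n ≥ 3) and g constant with value b₀. Any two vertices of Kₙ are swapped by an
-- automorphism, so a fixing set misses at most one vertex and fix(Kₙ) = n − 1. In the
-- functigraph the same holds for the copy A of Kₙ and for B ∖ {b₀}, which gives
-- fix(F) ≥ (n − 1) + (n − 2); conversely the complement of {a₀, b₀, b₁} is fixing, since
-- a₁ and b₂ already tell a₀, b₀, b₁ apart by adjacency. Hence fix(F) − fix(G) = n − 2.
module Submission where

open import Defs hiding (sym)
open import Data.Bool using (not)
open import Data.Empty using (⊥-elim)
open import Data.Fin using (Fin; zero; suc; _≟_)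
import Data.Fin as Fin
open import Data.Fin.Permutation using (Permutation′; _⟨$⟩ʳ_; _⟨$⟩ˡ_; inverseˡ; inverseʳ; transpose)
import Data.Fin.Permutation.Components as PC
open import Data.Fin.Properties using (suc-injective)
open import Data.List using (List; []; _∷_; length; _++_; filter; tabulate; allFin)
open import Data.List.Properties using (length-tabulate; length-++; length-removeAt′; filter-all)
open import Data.List.Membership.Propositional using (_∈_; _∉_)
open import Data.List.Membership.Propositional.Properties
  using (∈-filter⁻; ∈-tabulate⁺; ∈-tabulate⁻; ∈-++⁺ˡ; ∈-++⁺ʳ; ∈-++⁻)
import Data.List.Membership.DecPropositional as DecMembership
open import Data.List.Relation.Binary.Disjoint.Propositional using (Disjoint)
open import Data.List.Relation.Binary.Subset.Propositional using (_⊆_)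
import Data.List.Relation.Unary.All as All
open import Data.List.Relation.Unary.AllPairs as AllPairs using (AllPairs; []; _∷_)
import Data.List.Relation.Unary.AllPairs.Properties as AllPairsₚ
open import Data.List.Relation.Unary.Any using (here; there; index; _─_)
open import Data.List.Relation.Unary.Unique.Propositional using (Unique)
import Data.List.Relation.Unary.Unique.Propositional.Properties as Uniqueₚ
open import Data.Nat using (ℕ; suc; _≤_; _+_; z≤n; s≤s)
open import Data.Nat.Properties using (≤-refl; ≤-trans; ≤-pred; +-mono-≤)
open import Data.Product using (Σ; _×_; _,_; proj₁; proj₂)
open import Data.Sum using (_⊎_; inj₁; inj₂)
import Data.Sum as Sum
open import Data.Sum.Properties using (≡-dec; inj₁-injective; inj₂-injective)
open import Function using (_∘_; _⇔_; mk⇔)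
open import Relation.Binary.Definitions using (DecidableEquality)
open import Relation.Binary.PropositionalEquality
  using (_≡_; _≢_; refl; sym; trans; cong; cong₂; subst)
open import Relation.Nullary using (Dec; yes; no)
open import Relation.Nullary.Decidable using (⌊_⌋; isYes≗does; does-⇔; dec-true; dec-false)
open import Relation.Unary using (Decidable)

module _ {A : Set} where

  ∈-─⁺ : {x y : A} {xs : List A} (x∈xs : x ∈ xs) → y ∈ xs → y ≢ x → y ∈ (xs ─ x∈xs)
  ∈-─⁺ (here refl) (here refl) y≢x = ⊥-elim (y≢x refl)
  ∈-─⁺ (here refl) (there y∈xs) y≢x = y∈xs
  ∈-─⁺ (there x∈xs) (here refl) y≢x = here refl
  ∈-─⁺ (there x∈xs) (there y∈xs) y≢x = there (∈-─⁺ x∈xs y∈xs y≢x)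

  Unique-⊆⇒length≤ : {xs ys : List A} → Unique xs → xs ⊆ ys → length xs ≤ length ys
  Unique-⊆⇒length≤ [] xs⊆ys = z≤n
  Unique-⊆⇒length≤ {x ∷ xs} {ys} (x∉xs ∷ unique) xs⊆ys =
    subst (suc (length xs) ≤_) (sym (length-removeAt′ ys (index x∈ys)))
      (s≤s (Unique-⊆⇒length≤ unique λ y∈xs →
        ∈-─⁺ x∈ys (xs⊆ys (there y∈xs)) (All.lookup x∉xs y∈xs ∘ sym)))
    where
      x∈ys : x ∈ ys
      x∈ys = xs⊆ys (here refl)

  length≤1+length-filter : {P : A → Set} (P? : Decidable P) {xs : List A} →
    AllPairs (λ x y → P x ⊎ P y) xs → length xs ≤ suc (length (filter P? xs))
  length≤1+length-filter P? [] = z≤n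
  length≤1+length-filter P? {x ∷ xs} (Px⊎Py ∷ pairs) with P? x
  ... | yes _ = s≤s (length≤1+length-filter P? pairs)
  ... | no ¬Px = s≤s (subst (λ ys → length xs ≤ length ys)
                        (sym (filter-all P? (All.map (Sum.[ ⊥-elim ∘ ¬Px , (λ Py → Py) ]) Px⊎Py)))
                        ≤-refl)

module _ {V : Set} {H : Graph V} where

  aut-injective : (σ : Aut H) {u v : V} → fun σ u ≡ fun σ v → u ≡ v
  aut-injective σ {u} {v} σu≡σv = trans (sym (left σ u)) (trans (cong (inv σ) σu≡σv) (left σ v))

  preserv-fixedʳ : (σ : Aut H) {v s : V} → fun σ s ≡ s → adj H (fun σ v) s ≡ adj H v s
  preserv-fixedʳ σ {v} {s} σs≡s = trans (cong (adj H (fun σ v)) (sym σs≡s)) (preserv σ v s)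

-- Only x ↦ y is required; bijectivity then forces y ↦ x.
record Transposition {V : Set} (H : Graph V) (x y : V) : Set where
  field
    aut          : Aut H
    maps         : fun aut x ≡ y
    fixes-others : ∀ v → v ≢ x → v ≢ y → fun aut v ≡ v
open Transposition

TwinClass : {V : Set} → Graph V → List V → Set
TwinClass H = AllPairs (λ x y → x ≢ y × Transposition H x y)

module _ {V : Set} (_≟ᵥ_ : DecidableEquality V) where

  open DecMembership _≟ᵥ_ using (_∈?_)

  filter-∈-⊆ : (S C : List V) → filter (_∈? S) C ⊆ S
  filter-∈-⊆ S C = proj₂ ∘ ∈-filter⁻ (_∈? S) {xs = C}

  module _ {H : Graph V} where

    fixingSet-meets-transposition : {S : List V} → FixingSet H S →
      {x y : V} → x ≢ y → Transposition H x y → x ∈ S ⊎ y ∈ S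
    fixingSet-meets-transposition {S} fixing {x} {y} x≢y τ with x ∈? S | y ∈? S
    ... | yes x∈S | _ = inj₁ x∈S
    ... | no _ | yes y∈S = inj₂ y∈S
    ... | no x∉S | no y∉S = ⊥-elim (x≢y (trans (sym (fixing (aut τ) fixesS x)) (maps τ)))
      where
        fixesS : ∀ v → v ∈ S → fun (aut τ) v ≡ v
        fixesS v v∈S = fixes-others τ v (λ { refl → x∉S v∈S }) (λ { refl → y∉S v∈S })

    twinClass-length≤ : {S C : List V} → FixingSet H S → TwinClass H C →
      length C ≤ suc (length (filter (_∈? S) C))
    twinClass-length≤ fixing twins = length≤1+length-filter (_∈? _)
      (AllPairs.map (λ (x≢y , τ) → fixingSet-meets-transposition fixing x≢y τ) twins)

    filter-twinClass-unique : (S : List V) {C : List V} → TwinClass H C → Unique (filter (_∈? S) C)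
    filter-twinClass-unique S twins = Uniqueₚ.filter⁺ (_∈? S) (AllPairs.map proj₁ twins)

    twinClass-length≤-fixingSet : {S C : List V} → FixingSet H S → TwinClass H C →
      length C ≤ suc (length S)
    twinClass-length≤-fixingSet {S} {C} fixing twins = ≤-trans (twinClass-length≤ fixing twins)
      (s≤s (Unique-⊆⇒length≤ (filter-twinClass-unique S twins) (filter-∈-⊆ S C)))

    -- An automorphism fixing S keeps a vertex outside S outside S (injectivity) and preserves
    -- its adjacencies to S.
    distinguishing⇒fixingSet : (S : List V) →
      (∀ v w → v ∉ S → w ∉ S → (∀ s → s ∈ S → adj H v s ≡ adj H w s) → v ≡ w) →
      FixingSet H S
    distinguishing⇒fixingSet S distinguishing σ fixesS v with v ∈? S | fun σ v ∈? S
    ... | yes v∈S | _ = fixesS v v∈S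
    ... | no v∉S | yes σv∈S =
      ⊥-elim (v∉S (subst (_∈ S) (sym (aut-injective σ (sym (fixesS _ σv∈S)))) σv∈S))
    ... | no v∉S | no σv∉S =
      distinguishing (fun σ v) v σv∉S v∉S (λ s s∈S → preserv-fixedʳ σ (fixesS s s∈S))

⌊⌋-⇔ : {A B : Set} → A ⇔ B → (a? : Dec A) (b? : Dec B) → ⌊ a? ⌋ ≡ ⌊ b? ⌋
⌊⌋-⇔ A⇔B a? b? = trans (isYes≗does a?) (trans (does-⇔ A⇔B a? b?) (sym (isYes≗does b?)))

⌊≟⌋-injective : {n : ℕ} {f : Fin n → Fin n} → (∀ {u v} → f u ≡ f v → u ≡ v) →
  ∀ u v → ⌊ f u ≟ f v ⌋ ≡ ⌊ u ≟ v ⌋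
⌊≟⌋-injective {f = f} f-injective u v = ⌊⌋-⇔ (mk⇔ f-injective (cong f)) (f u ≟ f v) (u ≟ v)

transpose-mapsˡ : {n : ℕ} (i j : Fin n) → PC.transpose i j i ≡ j
transpose-mapsˡ i j with i ≟ i
... | yes _ = refl
... | no i≢i = ⊥-elim (i≢i refl)

transpose-fixes : {n : ℕ} (i j k : Fin n) → k ≢ i → k ≢ j → PC.transpose i j k ≡ k
transpose-fixes i j k k≢i k≢j with k ≟ i
... | yes k≡i = ⊥-elim (k≢i k≡i)
... | no _ with k ≟ j
...   | yes k≡j = ⊥-elim (k≢j k≡j)
...   | no _ = refl

complete : (n : ℕ) → Graph (Fin n)
complete n = record
  { adj    = λ u v → not ⌊ u ≟ v ⌋
  ; sym    = λ u v → cong not (⌊⌋-⇔ (mk⇔ sym sym) (u ≟ v) (v ≟ u))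
  ; irrefl = λ v → cong not (trans (isYes≗does (v ≟ v)) (dec-true (v ≟ v) refl))
  }

complete-connected : (n : ℕ) → Connected (complete n)
complete-connected n u v with u ≟ v
... | yes refl = here
... | no u≢v = step (cong not (trans (isYes≗does (u ≟ v)) (dec-false (u ≟ v) u≢v))) here

permutation⇒aut : {n : ℕ} → Permutation′ n → Aut (complete n)
permutation⇒aut π = record
  { fun     = π ⟨$⟩ʳ_
  ; inv     = π ⟨$⟩ˡ_
  ; left    = λ _ → inverseˡ π
  ; right   = λ _ → inverseʳ π
  ; preserv = λ u v → cong not (⌊≟⌋-injective π-injective u v)
  }
  where
    π-injective : ∀ {u v} → π ⟨$⟩ʳ u ≡ π ⟨$⟩ʳ v → u ≡ v
    π-injective πu≡πv = trans (sym (inverseˡ π)) (trans (cong (π ⟨$⟩ˡ_) πu≡πv) (inverseˡ π))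

complete-transposition : {n : ℕ} (i j : Fin n) → Transposition (complete n) i j
complete-transposition i j = record
  { aut          = permutation⇒aut (transpose i j)
  ; maps         = transpose-mapsˡ i j
  ; fixes-others = λ k → transpose-fixes i j k
  }

allFin-twinClass : (n : ℕ) → TwinClass (complete n) (allFin n)
allFin-twinClass n = AllPairsₚ.tabulate⁺ (λ {i} {j} i≢j → i≢j , complete-transposition i j)

fix-complete : (m : ℕ) → IsFixNumber (complete (suc m)) m
fix-complete m =
  (tabulate suc , Uniqueₚ.tabulate⁺ suc-injective , length-tabulate suc , fixing) ,
  λ S _ fixingS → ≤-pred (subst (_≤ suc (length S)) (length-tabulate (λ i → i))
    (twinClass-length≤-fixingSet _≟_ fixingS (allFin-twinClass (suc m))))
  where
    fixing : FixingSet (complete (suc m)) (tabulate suc)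
    fixing = distinguishing⇒fixingSet _≟_ (tabulate suc) λ
      { zero    zero    _   _   _ → refl
      ; (suc i) _       i∉S _   _ → ⊥-elim (i∉S (∈-tabulate⁺ i))
      ; zero    (suc j) _   j∉S _ → ⊥-elim (j∉S (∈-tabulate⁺ j)) }

module _ {n : ℕ} {G : Graph (Fin n)} {g : Fin n → Fin n} where

  functigraph-autˡ : (π : Aut G) → (∀ a → g (fun π a) ≡ g a) → Aut (Functigraph G g)
  functigraph-autˡ π g∘π≡g = record
    { fun = Sum.map₁ (fun π) ; inv = Sum.map₁ (inv π)
    ; left = left′ ; right = right′ ; preserv = preserv′ }
    where
      left′ : ∀ v → Sum.map₁ (inv π) (Sum.map₁ (fun π) v) ≡ v
      left′ (inj₁ a) = cong inj₁ (left π a)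
      left′ (inj₂ b) = refl
      right′ : ∀ v → Sum.map₁ (fun π) (Sum.map₁ (inv π) v) ≡ v
      right′ (inj₁ a) = cong inj₁ (right π a)
      right′ (inj₂ b) = refl
      preserv′ : ∀ u v → fgAdj G g (Sum.map₁ (fun π) u) (Sum.map₁ (fun π) v) ≡ fgAdj G g u v
      preserv′ (inj₁ a) (inj₁ a′) = preserv π a a′
      preserv′ (inj₁ a) (inj₂ b) = cong (λ c → ⌊ c ≟ b ⌋) (g∘π≡g a)
      preserv′ (inj₂ b) (inj₁ a) = cong (λ c → ⌊ c ≟ b ⌋) (g∘π≡g a)
      preserv′ (inj₂ b) (inj₂ b′) = refl

  functigraph-autʳ : (π : Aut G) → (∀ a → fun π (g a) ≡ g a) → Aut (Functigraph G g)
  functigraph-autʳ π π∘g≡g = record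
    { fun = Sum.map₂ (fun π) ; inv = Sum.map₂ (inv π)
    ; left = left′ ; right = right′ ; preserv = preserv′ }
    where
      left′ : ∀ v → Sum.map₂ (inv π) (Sum.map₂ (fun π) v) ≡ v
      left′ (inj₁ a) = refl
      left′ (inj₂ b) = cong inj₂ (left π b)
      right′ : ∀ v → Sum.map₂ (fun π) (Sum.map₂ (inv π) v) ≡ v
      right′ (inj₁ a) = refl
      right′ (inj₂ b) = cong inj₂ (right π b)
      edge : ∀ a b → ⌊ g a ≟ fun π b ⌋ ≡ ⌊ g a ≟ b ⌋
      edge a b = ⌊⌋-⇔ (mk⇔ (λ ga≡πb → aut-injective π (trans (π∘g≡g a) ga≡πb))
                           (λ { refl → sym (π∘g≡g a) }))
                      (g a ≟ fun π b) (g a ≟ b)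
      preserv′ : ∀ u v → fgAdj G g (Sum.map₂ (fun π) u) (Sum.map₂ (fun π) v) ≡ fgAdj G g u v
      preserv′ (inj₁ a) (inj₁ a′) = refl
      preserv′ (inj₁ a) (inj₂ b) = edge a b
      preserv′ (inj₂ b) (inj₁ a) = edge a b
      preserv′ (inj₂ b) (inj₂ b′) = preserv π b b′

  functigraph-transpositionˡ : {x y : Fin n} (τ : Transposition G x y) →
    (∀ a → g (fun (aut τ) a) ≡ g a) →
    Transposition (Functigraph G g) (inj₁ x) (inj₁ y)
  functigraph-transpositionˡ τ g∘τ≡g = record
    { aut          = functigraph-autˡ (aut τ) g∘τ≡g
    ; maps         = cong inj₁ (maps τ)
    ; fixes-others = λ
      { (inj₁ a) a≢x a≢y → cong inj₁ (fixes-others τ a (a≢x ∘ cong inj₁) (a≢y ∘ cong inj₁))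
      ; (inj₂ b) _ _ → refl }
    }

  functigraph-transpositionʳ : {x y : Fin n} (τ : Transposition G x y) →
    (∀ a → fun (aut τ) (g a) ≡ g a) →
    Transposition (Functigraph G g) (inj₂ x) (inj₂ y)
  functigraph-transpositionʳ τ τ∘g≡g = record
    { aut          = functigraph-autʳ (aut τ) τ∘g≡g
    ; maps         = cong inj₂ (maps τ)
    ; fixes-others = λ
      { (inj₁ a) _ _ → refl
      ; (inj₂ b) b≢x b≢y → cong inj₂ (fixes-others τ b (b≢x ∘ cong inj₂) (b≢y ∘ cong inj₂)) }
    }

tabulate-inj₁-inj₂-disjoint : {A B : Set} {m n : ℕ} (f : Fin m → A) (h : Fin n → B) →
  Disjoint (tabulate (inj₁ ∘ f)) (tabulate (inj₂ ∘ h))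
tabulate-inj₁-inj₂-disjoint f h (v∈inj₁ , v∈inj₂)
  with ∈-tabulate⁻ {f = inj₁ ∘ f} v∈inj₁ | ∈-tabulate⁻ {f = inj₂ ∘ h} v∈inj₂
... | _ , refl | _ , ()

completeFunctigraph : (n : ℕ) → Graph (Fin (suc n) ⊎ Fin (suc n))
completeFunctigraph n = Functigraph (complete (suc n)) (λ _ → zero)

module _ (m : ℕ) where

  private
    V = Fin (suc (suc m)) ⊎ Fin (suc (suc m))
    F = completeFunctigraph (suc m)

    _≟ᵥ_ : DecidableEquality V
    _≟ᵥ_ = ≡-dec _≟_ _≟_

  open DecMembership _≟ᵥ_ using (_∈?_)

  firstCopy-twinClass : TwinClass F (tabulate inj₁)
  firstCopy-twinClass = AllPairsₚ.tabulate⁺ λ {i} {j} i≢j →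
    i≢j ∘ inj₁-injective , functigraph-transpositionˡ (complete-transposition i j) (λ _ → refl)

  secondCopy-twinClass : TwinClass F (tabulate (inj₂ ∘ suc))
  secondCopy-twinClass = AllPairsₚ.tabulate⁺ λ {i} {j} i≢j →
    i≢j ∘ suc-injective ∘ inj₂-injective ,
    functigraph-transpositionʳ (complete-transposition (suc i) (suc j))
      (λ _ → transpose-fixes (suc i) (suc j) zero (λ ()) (λ ()))

  completeFunctigraph-fixingSet-length≥ : (S : List V) → FixingSet F S → suc m + m ≤ length S
  completeFunctigraph-fixingSet-length≥ S fixing =
    ≤-trans (+-mono-≤ L₁-length≥ L₂-length≥) (subst (_≤ length S) (length-++ L₁) L₁++L₂-length≤)
    where
      L₁ L₂ : List V
      L₁ = filter (_∈? S) (tabulate inj₁)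
      L₂ = filter (_∈? S) (tabulate (inj₂ ∘ suc))

      L₁-length≥ : suc m ≤ length L₁
      L₁-length≥ = ≤-pred (subst (_≤ suc (length L₁)) (length-tabulate inj₁)
        (twinClass-length≤ _≟ᵥ_ fixing firstCopy-twinClass))

      L₂-length≥ : m ≤ length L₂
      L₂-length≥ = ≤-pred (subst (_≤ suc (length L₂)) (length-tabulate (inj₂ ∘ suc))
        (twinClass-length≤ _≟ᵥ_ fixing secondCopy-twinClass))

      disjoint : Disjoint L₁ L₂
      disjoint (v∈L₁ , v∈L₂) = tabulate-inj₁-inj₂-disjoint (λ i → i) suc
        (proj₁ (∈-filter⁻ (_∈? S) v∈L₁) , proj₁ (∈-filter⁻ (_∈? S) v∈L₂))

      L₁++L₂-length≤ : length (L₁ ++ L₂) ≤ length S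
      L₁++L₂-length≤ = Unique-⊆⇒length≤
        (Uniqueₚ.++⁺ (filter-twinClass-unique _≟ᵥ_ S firstCopy-twinClass)
                     (filter-twinClass-unique _≟ᵥ_ S secondCopy-twinClass) disjoint)
        (Sum.[ filter-∈-⊆ _≟ᵥ_ S _ , filter-∈-⊆ _≟ᵥ_ S _ ] ∘ ∈-++⁻ L₁)

module _ (k : ℕ) where

  private
    V = Fin (suc (suc (suc k))) ⊎ Fin (suc (suc (suc k)))
    F = completeFunctigraph (suc (suc k))

  a₁₊ : Fin (suc (suc k)) → V
  a₁₊ = inj₁ ∘ Fin.suc

  b₂₊ : Fin (suc k) → V
  b₂₊ = inj₂ ∘ Fin.suc ∘ Fin.suc

  fixingWitness : List V
  fixingWitness = tabulate a₁₊ ++ tabulate b₂₊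

  private
    a∈ : (i : Fin (suc (suc k))) → a₁₊ i ∈ fixingWitness
    a∈ i = ∈-++⁺ˡ (∈-tabulate⁺ {f = a₁₊} i)

    b∈ : (j : Fin (suc k)) → b₂₊ j ∈ fixingWitness
    b∈ j = ∈-++⁺ʳ (tabulate a₁₊) (∈-tabulate⁺ {f = b₂₊} j)

  -- a₁ is adjacent to a₀ and b₀ but not to b₁; b₂ is adjacent to b₀ and b₁ but not to a₀.
  fixingWitness-distinguishing : ∀ v w → v ∉ fixingWitness → w ∉ fixingWitness →
    (∀ s → s ∈ fixingWitness → adj F v s ≡ adj F w s) → v ≡ w
  fixingWitness-distinguishing (inj₁ (suc i)) _ v∉ _ _ = ⊥-elim (v∉ (a∈ i))
  fixingWitness-distinguishing (inj₂ (suc (suc j))) _ v∉ _ _ = ⊥-elim (v∉ (b∈ j))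
  fixingWitness-distinguishing _ (inj₁ (suc i)) _ w∉ _ = ⊥-elim (w∉ (a∈ i))
  fixingWitness-distinguishing _ (inj₂ (suc (suc j))) _ w∉ _ = ⊥-elim (w∉ (b∈ j))
  fixingWitness-distinguishing (inj₁ zero) (inj₁ zero) _ _ _ = refl
  fixingWitness-distinguishing (inj₂ zero) (inj₂ zero) _ _ _ = refl
  fixingWitness-distinguishing (inj₂ (suc zero)) (inj₂ (suc zero)) _ _ _ = refl
  fixingWitness-distinguishing (inj₁ zero) (inj₂ zero) _ _ same with () ← same _ (b∈ zero)
  fixingWitness-distinguishing (inj₁ zero) (inj₂ (suc zero)) _ _ same with () ← same _ (b∈ zero)
  fixingWitness-distinguishing (inj₂ zero) (inj₁ zero) _ _ same with () ← same _ (b∈ zero)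
  fixingWitness-distinguishing (inj₂ zero) (inj₂ (suc zero)) _ _ same with () ← same _ (a∈ zero)
  fixingWitness-distinguishing (inj₂ (suc zero)) (inj₁ zero) _ _ same with () ← same _ (b∈ zero)
  fixingWitness-distinguishing (inj₂ (suc zero)) (inj₂ zero) _ _ same with () ← same _ (a∈ zero)

  fix-completeFunctigraph : IsFixNumber F (suc (suc k) + suc k)
  fix-completeFunctigraph =
    (fixingWitness , unique , length-fixingWitness ,
     distinguishing⇒fixingSet (≡-dec _≟_ _≟_) fixingWitness fixingWitness-distinguishing) ,
    λ S _ → completeFunctigraph-fixingSet-length≥ (suc k) S
    where
      unique : Unique fixingWitness
      unique = Uniqueₚ.++⁺ (Uniqueₚ.tabulate⁺ (suc-injective ∘ inj₁-injective))
        (Uniqueₚ.tabulate⁺ (suc-injective ∘ suc-injective ∘ inj₂-injective))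
        (tabulate-inj₁-inj₂-disjoint Fin.suc (Fin.suc ∘ Fin.suc))

      length-fixingWitness : length fixingWitness ≡ suc (suc k) + suc k
      length-fixingWitness =
        trans (length-++ (tabulate a₁₊)) (cong₂ _+_ (length-tabulate a₁₊) (length-tabulate b₂₊))

mainTheorem7 : (t : ℕ) → 2 ≤ t →
    Σ ℕ λ n → 1 ≤ n × Σ (Graph (Fin n)) λ G → Connected G ×
    Σ (Fin n → Fin n) λ g → Σ ℕ λ a → Σ ℕ λ b →
    IsFixNumber G a × IsFixNumber (Functigraph G g) b × b ≡ a + t
mainTheorem7 (suc (suc k)) (s≤s (s≤s z≤n)) =
  suc (suc (suc (suc k))) , s≤s z≤n , complete _ , complete-connected _ , (λ _ → zero) ,
  suc (suc (suc k)) , suc (suc (suc k)) + suc (suc k) ,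
  fix-complete (suc (suc (suc k))) , fix-completeFunctigraph (suc k) , refl
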